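{- Let $U(n)$ denote the total number of ON cells in the Ulam-Warburton cellular automaton up to and including generation $n$ (with $U(0)=0$). For integers $m \geq 1$ let $$a_m=\sum_{i=0}^{m-1}3^{\operatorname{wt}(i)},$$ where $\operatorname{wt}(i)$ is the number of 1's in the binary expansion of $i$. Then for all integers $m\ge 1$ and $k\ge 0$, setting $n_m=m\cdot 2^k$, $$U(n_m)=\frac{a_m}{m^2}\cdot\frac{4}{3}\,n_m^2-\frac{1}{3},$$ equivalently $U(m\cdot 2^k)=a_m\cdot\frac{4}{3}\,2^{2k}-\frac{1}{3}$.
   Context: The Ulam-Warburton cellular automaton lives on the grid of unit square cells of the plane (cells indexed by $\mathbb{Z}^2$, two cells being neighbours when they share an edge, i.e. the von Neumann neighbourhood). At generation $1$ exactly one cell is ON and all others are OFF. For each subsequent generation, every OFF cell that shares an edge with precisely one ON cell is turned ON; cells that are ON remain ON forever. Let $u(n)$ be the number of cells newly turned ON at generation $n$ (so $u(0)=0$, $u(1)=1$), and $U(n)=\sum_{i=0}^{n}u(i)$ is the total number of ON cells after generation $n$. -}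

module Defs where

open import Data.Bool using (Bool; true; false; _∧_; _∨_; if_then_else_)
open import Data.Nat using (ℕ; zero; suc; _+_; _*_; _^_; _≡ᵇ_; _%_; _/_)
open import Data.Integer as ℤ using (ℤ; +_; _-_)
open import Data.List using (List; map; upTo; concatMap)
open import Data.Nat.ListAction using (sum)
open import Relation.Nullary.Decidable using (⌊_⌋)

b2n : Bool → ℕ
b2n true  = 1
b2n false = 0

isOrigin : ℤ → ℤ → Bool
isOrigin x y = ⌊ x ℤ.≟ + 0 ⌋ ∧ ⌊ y ℤ.≟ + 0 ⌋

mutual
  on : ℕ → ℤ → ℤ → Bool
  on zero          x y = false
  on (suc zero)    x y = isOrigin x y
  on (suc (suc n)) x y = on (suc n) x y ∨ (onNbrs (suc n) x y ≡ᵇ 1)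

  onNbrs : ℕ → ℤ → ℤ → ℕ
  onNbrs n x y = b2n (on n (x ℤ.+ + 1) y) + b2n (on n (x - + 1) y)
               + b2n (on n x (y ℤ.+ + 1)) + b2n (on n x (y - + 1))

box : ℕ → List ℤ
box R = map (λ i → + i - + R) (upTo (suc (2 * R)))

-- U n = number of ON cells after generation n.  All ON cells after
-- generation n lie in the square [-n, n]², so counting there is exact.
U : ℕ → ℕ
U n = sum (concatMap (λ x → map (λ y → b2n (on n x y)) (box n)) (box n))

-- binary weight (number of 1's in binary expansion); fuel i suffices
wtAux : ℕ → ℕ → ℕ
wtAux zero    i = 0
wtAux (suc f) i = i % 2 + wtAux f (i / 2)

wt : ℕ → ℕ
wt i = wtAux i i

a : ℕ → ℕ
a m = sum (map (λ i → 3 ^ wt i) (upTo m))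

module Submission where

-- Put F n = 3 · U n + 1.  Both F and 4 · a satisfy, for n ≥ 1,
--     f 1 = 4,   f (2n) = 4 · f n,   f (2n + 1) = f (n + 1) + 3 · f n,
-- so they agree on n ≥ 1; iterating F (2n) = 4 · F n then gives the theorem.
-- For a this follows from wt (2i) = wt i and wt (2i + 1) = wt i + 1.
-- For F it comes from a self-similarity of the automaton: after generation
-- 2m + 1 (resp. 2m + 2) the even–even cells (2x, 2y) copy generation m + 1,
-- the odd–odd cells are OFF, and each mixed cell is ON iff the "bridge" (pair
-- of adjacent cells) it represents contains an ON cell of generation m
-- (resp. m + 1).  After generation B there are 3 · U B + 1 such bridges, since
-- every newborn cell has exactly one ON neighbour and no two adjacent cells
-- are born together (by a checkerboard-colouring argument).

open import Defs
open import Data.Nat using (ℕ; _+_; _*_; _^_; _≥_)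
open import Relation.Binary.PropositionalEquality using (_≡_)

open import Relation.Binary.PropositionalEquality
  using (refl; sym; trans; cong; cong₂; subst; module ≡-Reasoning)
open import Data.Nat using (zero; suc; _≤_; _<_; s≤s; z≤n; _≡ᵇ_; _∸_; _%_; _/_)
import Data.Nat.Properties as ℕₚ
import Data.Nat.DivMod as DivMod
open import Data.Nat.Induction using (<-rec)
import Data.Nat.Tactic.RingSolver as ℕ-Solver
open import Data.Integer as ℤ using (ℤ; +_; -[1+_]; ∣_∣)
import Data.Integer.Properties as ℤₚ
import Data.Integer.Tactic.RingSolver as ℤ-Solver
open import Data.Bool using (Bool; true; false; _∧_; _∨_; not; _xor_)
import Data.Bool.Properties as Boolₚ
open import Data.Product using (_×_; _,_; proj₁; proj₂)
open import Data.Sum using (_⊎_; inj₁; inj₂) renaming (map to ⊎-map)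
open import Data.Empty using (⊥-elim)
open import Relation.Nullary using (yes; no)
open import Relation.Nullary.Decidable using (⌊_⌋)
open import Data.List using (List; []; _∷_; map; applyUpTo; concatMap)
open import Data.Nat.ListAction using (sum)
open import Data.Nat.ListAction.Properties using (sum-++)

-- (1) Integer arithmetic of neighbours

-- Every integer is of the form twice x or twiceSuc x; the rescaling lemma
-- describes the automaton separately on these four parity classes of cells.
twice : ℤ → ℤ
twice x = x ℤ.+ x

twiceSuc : ℤ → ℤ
twiceSuc x = + 1 ℤ.+ (x ℤ.+ x)

right-of-twice : ∀ x → (x ℤ.+ x) ℤ.+ + 1 ≡ + 1 ℤ.+ (x ℤ.+ x)
right-of-twice = ℤ-Solver.solve-∀

left-of-twice : ∀ x → (x ℤ.+ x) ℤ.- + 1 ≡ + 1 ℤ.+ ((x ℤ.- + 1) ℤ.+ (x ℤ.- + 1))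
left-of-twice = ℤ-Solver.solve-∀

right-of-twiceSuc : ∀ x → (+ 1 ℤ.+ (x ℤ.+ x)) ℤ.+ + 1 ≡ (x ℤ.+ + 1) ℤ.+ (x ℤ.+ + 1)
right-of-twiceSuc = ℤ-Solver.solve-∀

left-of-twiceSuc : ∀ x → (+ 1 ℤ.+ (x ℤ.+ x)) ℤ.- + 1 ≡ x ℤ.+ x
left-of-twiceSuc = ℤ-Solver.solve-∀

pred-then-suc : ∀ x → (x ℤ.- + 1) ℤ.+ + 1 ≡ x
pred-then-suc = ℤ-Solver.solve-∀

suc-then-pred : ∀ x → (x ℤ.+ + 1) ℤ.- + 1 ≡ x
suc-then-pred = ℤ-Solver.solve-∀

negSuc-then-suc : ∀ R → -[1+ R ] ℤ.+ + 1 ≡ ℤ.- (+ R)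
negSuc-then-suc zero    = refl
negSuc-then-suc (suc R) = refl

∣x∣≤1+∣x+1∣ : ∀ x → ∣ x ∣ ≤ suc ∣ x ℤ.+ + 1 ∣
∣x∣≤1+∣x+1∣ x = subst (λ z → ∣ z ∣ ≤ suc ∣ x ℤ.+ + 1 ∣) (suc-then-pred x)
  (ℕₚ.≤-trans (ℤₚ.∣i-j∣≤∣i∣+∣j∣ (x ℤ.+ + 1) (+ 1)) (ℕₚ.≤-reflexive (ℕₚ.+-comm _ 1)))

∣x∣≤1+∣x-1∣ : ∀ x → ∣ x ∣ ≤ suc ∣ x ℤ.- + 1 ∣
∣x∣≤1+∣x-1∣ x = subst (λ z → ∣ z ∣ ≤ suc ∣ x ℤ.- + 1 ∣) (pred-then-suc x)
  (ℕₚ.≤-trans (ℤₚ.∣i+j∣≤∣i∣+∣j∣ (x ℤ.- + 1) (+ 1)) (ℕₚ.≤-reflexive (ℕₚ.+-comm _ 1)))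

parityℕ : ℕ → Bool
parityℕ zero    = false
parityℕ (suc n) = not (parityℕ n)

parity : ℤ → Bool
parity (+ n)      = parityℕ n
parity -[1+ n ]   = not (parityℕ n)

colour : ℤ → ℤ → Bool
colour x y = parity x xor parity y

parityℕ-+1 : ∀ n → parityℕ (n + 1) ≡ not (parityℕ n)
parityℕ-+1 zero    = refl
parityℕ-+1 (suc n) = cong not (parityℕ-+1 n)

parity-+1 : ∀ x → parity (x ℤ.+ + 1) ≡ not (parity x)
parity-+1 (+ n)            = parityℕ-+1 n
parity-+1 -[1+ zero ]      = refl
parity-+1 -[1+ suc k ]     = sym (Boolₚ.not-involutive (not (parityℕ k)))

parity--1 : ∀ x → parity (x ℤ.- + 1) ≡ not (parity x)
parity--1 x = begin
    parity (x ℤ.- + 1)                        ≡⟨ sym (Boolₚ.not-involutive _) ⟩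
    not (not (parity (x ℤ.- + 1)))            ≡⟨ cong not (sym (parity-+1 (x ℤ.- + 1))) ⟩
    not (parity ((x ℤ.- + 1) ℤ.+ + 1))        ≡⟨ cong (λ z → not (parity z)) (pred-then-suc x) ⟩
    not (parity x)                            ∎
  where open ≡-Reasoning

colour-right : ∀ x y → colour (x ℤ.+ + 1) y ≡ not (colour x y)
colour-right x y rewrite parity-+1 x = sym (Boolₚ.not-distribˡ-xor (parity x) (parity y))

colour-left : ∀ x y → colour (x ℤ.- + 1) y ≡ not (colour x y)
colour-left x y rewrite parity--1 x = sym (Boolₚ.not-distribˡ-xor (parity x) (parity y))

colour-up : ∀ x y → colour x (y ℤ.+ + 1) ≡ not (colour x y)
colour-up x y rewrite parity-+1 y = sym (Boolₚ.not-distribʳ-xor (parity x) (parity y))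

colour-down : ∀ x y → colour x (y ℤ.- + 1) ≡ not (colour x y)
colour-down x y rewrite parity--1 y = sym (Boolₚ.not-distribʳ-xor (parity x) (parity y))

one-colour-matches : ∀ {c c'} p → c' ≡ not c → c ≡ p ⊎ c' ≡ p
one-colour-matches {true}  true  _    = inj₁ refl
one-colour-matches {false} false _    = inj₁ refl
one-colour-matches {true}  false refl = inj₂ refl
one-colour-matches {false} true  refl = inj₂ refl

-- (2) Basic dynamics

origin-coordinates : ∀ x y → isOrigin x y ≡ true → (x ≡ + 0) × (y ≡ + 0)
origin-coordinates x y h with x ℤ.≟ + 0 | y ℤ.≟ + 0
... | yes p | yes q = p , q
origin-coordinates x y () | yes p | no q
origin-coordinates x y () | no p  | _

origin-colour : ∀ x y → isOrigin x y ≡ true → colour x y ≡ false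
origin-colour x y h with origin-coordinates x y h
... | refl , refl = refl

not-origin : ∀ x y → colour x y ≡ true → isOrigin x y ≡ false
not-origin x y h with isOrigin x y in eq
... | false = refl
... | true with trans (sym (origin-colour x y eq)) h
...   | ()

on-mono : ∀ n x y → on n x y ≡ true → on (suc n) x y ≡ true
on-mono zero    x y ()
on-mono (suc n) x y h rewrite h = refl

on-mono-false : ∀ n x y → on (suc n) x y ≡ false → on n x y ≡ false
on-mono-false n x y h with on n x y in eq
... | false = refl
... | true  = trans (sym (on-mono n x y eq)) h

off-not-one-neighbour : ∀ m x y → on (suc m) x y ≡ false → (onNbrs m x y ≡ᵇ 1) ≡ false
off-not-one-neighbour zero    x y h = refl
off-not-one-neighbour (suc m) x y h = ∨-false h
  where
  ∨-false : ∀ {a b} → (a ∨ b) ≡ false → b ≡ false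
  ∨-false {false} h = h

-- Colour freezing: cells of colour parityℕ n do not change from generation
-- n + 1 to n + 2 (the cells born at generation n + 2 all have the other
-- colour).  By induction: the neighbours of such a cell have the other
-- colour, hence were frozen one generation earlier.
colour-frozen : ∀ n x y → colour x y ≡ parityℕ n → on (suc (suc n)) x y ≡ on (suc n) x y
colour-frozen zero x y h
  rewrite not-origin (x ℤ.+ + 1) y (trans (colour-right x y) (cong not h))
        | not-origin (x ℤ.- + 1) y (trans (colour-left x y) (cong not h))
        | not-origin x (y ℤ.+ + 1) (trans (colour-up x y) (cong not h))
        | not-origin x (y ℤ.- + 1) (trans (colour-down x y) (cong not h))
  = Boolₚ.∨-identityʳ (isOrigin x y)
colour-frozen (suc n) x y h =
  trans (cong (λ k → on (suc (suc n)) x y ∨ (k ≡ᵇ 1)) neighbours-frozen) (∨-repeat (on (suc n) x y) _)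
  where
  frozen : ∀ x' y' → colour x' y' ≡ not (colour x y) → on (suc (suc n)) x' y' ≡ on (suc n) x' y'
  frozen x' y' h' = colour-frozen n x' y' (trans h' (trans (cong not h) (Boolₚ.not-involutive (parityℕ n))))
  neighbours-frozen : onNbrs (suc (suc n)) x y ≡ onNbrs (suc n) x y
  neighbours-frozen
    rewrite frozen (x ℤ.+ + 1) y (colour-right x y) | frozen (x ℤ.- + 1) y (colour-left x y)
          | frozen x (y ℤ.+ + 1) (colour-up x y)    | frozen x (y ℤ.- + 1) (colour-down x y) = refl
  ∨-repeat : ∀ p q → ((p ∨ q) ∨ q) ≡ (p ∨ q)
  ∨-repeat true  q     = refl
  ∨-repeat false true  = refl
  ∨-repeat false false = refl

not-both-born : ∀ m x y x' y' → colour x' y' ≡ not (colour x y) →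
                on (suc m) x y ≡ true → on (suc m) x' y' ≡ true → (on m x y ∨ on m x' y') ≡ true
not-both-born zero x y x' y' opp h h'
  with trans (sym (origin-colour x' y' h')) (trans opp (cong not (origin-colour x y h)))
... | ()
not-both-born (suc k) x y x' y' opp h h' with one-colour-matches (parityℕ k) opp
... | inj₁ c rewrite trans (sym (colour-frozen k x y c)) h = refl
... | inj₂ c rewrite trans (sym (colour-frozen k x' y' c)) h' = Boolₚ.∨-zeroʳ _

not-both-born-horizontal : ∀ m x y → on (suc m) x y ≡ true → on (suc m) (x ℤ.+ + 1) y ≡ true →
                           (on m x y ∨ on m (x ℤ.+ + 1) y) ≡ true
not-both-born-horizontal m x y = not-both-born m x y (x ℤ.+ + 1) y (colour-right x y)

not-both-born-vertical : ∀ m x y → on (suc m) x y ≡ true → on (suc m) x (y ℤ.+ + 1) ≡ true →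
                         (on m x y ∨ on m x (y ℤ.+ + 1)) ≡ true
not-both-born-vertical m x y = not-both-born m x y x (y ℤ.+ + 1) (colour-up x y)

some-neighbour-on : ∀ a b c d → (b2n a + b2n b + b2n c + b2n d ≡ᵇ 1) ≡ true →
                    a ≡ true ⊎ b ≡ true ⊎ c ≡ true ⊎ d ≡ true
some-neighbour-on true  b     c     d    h = inj₁ refl
some-neighbour-on false true  c     d    h = inj₂ (inj₁ refl)
some-neighbour-on false false true  d    h = inj₂ (inj₂ (inj₁ refl))
some-neighbour-on false false false true h = inj₂ (inj₂ (inj₂ refl))

SupportedIn : ℕ → Set
SupportedIn n = ∀ x y → on n x y ≡ true → (∣ x ∣ < n) × (∣ y ∣ < n)

near-right : ∀ {k} x → ∣ x ℤ.+ + 1 ∣ < k → ∣ x ∣ < suc k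
near-right x lt = ℕₚ.≤-trans (s≤s (∣x∣≤1+∣x+1∣ x)) (s≤s lt)

near-left : ∀ {k} x → ∣ x ℤ.- + 1 ∣ < k → ∣ x ∣ < suc k
near-left x lt = ℕₚ.≤-trans (s≤s (∣x∣≤1+∣x-1∣ x)) (s≤s lt)

-- A cell born at generation k + 2 is adjacent to a cell ON after k + 1.
support-step : ∀ k → SupportedIn (suc k) → SupportedIn (suc (suc k))
support-step k ih x y h with on (suc k) x y in eq
... | true = ℕₚ.m<n⇒m<1+n (proj₁ (ih x y eq)) , ℕₚ.m<n⇒m<1+n (proj₂ (ih x y eq))
... | false with some-neighbour-on _ _ _ _ h
... | inj₁ h'               = near-right x (proj₁ (ih _ _ h')) , ℕₚ.m<n⇒m<1+n (proj₂ (ih _ _ h'))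
... | inj₂ (inj₁ h')        = near-left x (proj₁ (ih _ _ h'))  , ℕₚ.m<n⇒m<1+n (proj₂ (ih _ _ h'))
... | inj₂ (inj₂ (inj₁ h')) = ℕₚ.m<n⇒m<1+n (proj₁ (ih _ _ h')) , near-right y (proj₂ (ih _ _ h'))
... | inj₂ (inj₂ (inj₂ h')) = ℕₚ.m<n⇒m<1+n (proj₁ (ih _ _ h')) , near-left y (proj₂ (ih _ _ h'))

support : ∀ n → SupportedIn n
support zero x y ()
support (suc zero) x y h with origin-coordinates x y h
... | refl , refl = s≤s z≤n , s≤s z≤n
support (suc (suc k)) = support-step k (support (suc k))

Outside : ℕ → ℤ → ℤ → Set
Outside R x y = R ≤ ∣ x ∣ ⊎ R ≤ ∣ y ∣

off-outside : ∀ n x y → Outside n x y → on n x y ≡ false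
off-outside n x y out with on n x y in eq
... | false = refl
... | true with out
...   | inj₁ le = ⊥-elim (ℕₚ.<⇒≱ (proj₁ (support n x y eq)) le)
...   | inj₂ le = ⊥-elim (ℕₚ.<⇒≱ (proj₂ (support n x y eq)) le)

-- (3) The rescaling lemma

record Rescaling (T A B : ℕ) : Set where
  field
    even-even : ∀ x y → on T (twice x) (twice y) ≡ on A x y
    odd-even  : ∀ x y → on T (twiceSuc x) (twice y) ≡ (on B x y ∨ on B (x ℤ.+ + 1) y)
    even-odd  : ∀ x y → on T (twice x) (twiceSuc y) ≡ (on B x y ∨ on B x (y ℤ.+ + 1))
    odd-odd   : ∀ x y → on T (twiceSuc x) (twiceSuc y) ≡ false

neighbour-count-cong : ∀ {a b c d a' b' c' d'} → a ≡ a' → b ≡ b' → c ≡ c' → d ≡ d' →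
                       b2n a + b2n b + b2n c + b2n d ≡ b2n a' + b2n b' + b2n c' + b2n d'
neighbour-count-cong refl refl refl refl = refl

module RescaledNeighbours {T A B : ℕ} (R : Rescaling T A B) where
  open Rescaling R

  nbrs-even-even : ∀ x y → onNbrs T (twice x) (twice y) ≡
    b2n (on B x y ∨ on B (x ℤ.+ + 1) y) + b2n (on B (x ℤ.- + 1) y ∨ on B x y)
    + b2n (on B x y ∨ on B x (y ℤ.+ + 1)) + b2n (on B x (y ℤ.- + 1) ∨ on B x y)
  nbrs-even-even x y = neighbour-count-cong
    (trans (cong (λ z → on T z (twice y)) (right-of-twice x)) (odd-even x y))
    (trans (cong (λ z → on T z (twice y)) (left-of-twice x))
      (trans (odd-even (x ℤ.- + 1) y) (cong (λ z → on B (x ℤ.- + 1) y ∨ on B z y) (pred-then-suc x))))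
    (trans (cong (on T (twice x)) (right-of-twice y)) (even-odd x y))
    (trans (cong (on T (twice x)) (left-of-twice y))
      (trans (even-odd x (y ℤ.- + 1)) (cong (λ z → on B x (y ℤ.- + 1) ∨ on B x z) (pred-then-suc y))))

  nbrs-odd-even : ∀ x y → onNbrs T (twiceSuc x) (twice y) ≡ b2n (on A (x ℤ.+ + 1) y) + b2n (on A x y)
  nbrs-odd-even x y = trans (neighbour-count-cong
    (trans (cong (λ z → on T z (twice y)) (right-of-twiceSuc x)) (even-even (x ℤ.+ + 1) y))
    (trans (cong (λ z → on T z (twice y)) (left-of-twiceSuc x)) (even-even x y))
    (trans (cong (on T (twiceSuc x)) (right-of-twice y)) (odd-odd x y))
    (trans (cong (on T (twiceSuc x)) (left-of-twice y)) (odd-odd x (y ℤ.- + 1))))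
    (trans (ℕₚ.+-identityʳ _) (ℕₚ.+-identityʳ _))

  nbrs-even-odd : ∀ x y → onNbrs T (twice x) (twiceSuc y) ≡ b2n (on A x (y ℤ.+ + 1)) + b2n (on A x y)
  nbrs-even-odd x y = neighbour-count-cong
    (trans (cong (λ z → on T z (twiceSuc y)) (right-of-twice x)) (odd-odd x y))
    (trans (cong (λ z → on T z (twiceSuc y)) (left-of-twice x)) (odd-odd (x ℤ.- + 1) y))
    (trans (cong (on T (twice x)) (right-of-twiceSuc y)) (even-even x (y ℤ.+ + 1)))
    (trans (cong (on T (twice x)) (left-of-twiceSuc y)) (even-even x y))

  nbrs-odd-odd : ∀ x y → onNbrs T (twiceSuc x) (twiceSuc y) ≡
    b2n (on B (x ℤ.+ + 1) y ∨ on B (x ℤ.+ + 1) (y ℤ.+ + 1)) + b2n (on B x y ∨ on B x (y ℤ.+ + 1))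
    + b2n (on B x (y ℤ.+ + 1) ∨ on B (x ℤ.+ + 1) (y ℤ.+ + 1)) + b2n (on B x y ∨ on B (x ℤ.+ + 1) y)
  nbrs-odd-odd x y = neighbour-count-cong
    (trans (cong (λ z → on T z (twiceSuc y)) (right-of-twiceSuc x)) (even-odd (x ℤ.+ + 1) y))
    (trans (cong (λ z → on T z (twiceSuc y)) (left-of-twiceSuc x)) (even-odd x y))
    (trans (cong (on T (twiceSuc x)) (right-of-twiceSuc y)) (odd-even x (y ℤ.+ + 1)))
    (trans (cong (on T (twiceSuc x)) (left-of-twiceSuc y)) (odd-even x y))

-- Even–even cell, odd step: a (resp. a') is the cell after generation m
-- (resp. m + 1) and r, l, u, d its neighbours after m; the cell does not change.
even-cell-frozen : ∀ a a' r l u d → (a' ≡ false → a ≡ false) →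
  (a' ≡ false → (b2n r + b2n l + b2n u + b2n d ≡ᵇ 1) ≡ false) →
  (a' ∨ (b2n (a ∨ r) + b2n (l ∨ a) + b2n (a ∨ u) + b2n (d ∨ a) ≡ᵇ 1)) ≡ a'
even-cell-frozen a true  r l u d _    _    = refl
even-cell-frozen a false r l u d off₁ off₂
  rewrite off₁ refl | Boolₚ.∨-identityʳ l | Boolₚ.∨-identityʳ d = off₂ refl

-- Even–even cell, even step: the cell follows one generation of the
-- coarse automaton, because a bridge touching an ON cell a never counts
-- unless a is ON already.
even-cell-follows : ∀ a r l u d →
  (a ∨ (b2n (a ∨ r) + b2n (l ∨ a) + b2n (a ∨ u) + b2n (d ∨ a) ≡ᵇ 1)) ≡
  (a ∨ (b2n r + b2n l + b2n u + b2n d ≡ᵇ 1))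
even-cell-follows true  r l u d = refl
even-cell-follows false r l u d rewrite Boolₚ.∨-identityʳ l | Boolₚ.∨-identityʳ d = refl

-- Mixed cell between two even–even cells a' and b' (after the next coarse
-- generation; a, b before): it becomes a' ∨ b', using that a' and b' are not
-- both newborn.
mixed-cell-step : ∀ a b a' b' → (a ≡ true → a' ≡ true) → (b ≡ true → b' ≡ true) →
  (a' ≡ true → b' ≡ true → (a ∨ b) ≡ true) →
  ((a ∨ b) ∨ (b2n b' + b2n a' ≡ᵇ 1)) ≡ (a' ∨ b')
mixed-cell-step true  b     a'    b'    mono-a _      _    rewrite mono-a refl = refl
mixed-cell-step false true  a'    b'    _      mono-b _    rewrite mono-b refl = sym (Boolₚ.∨-zeroʳ a')
mixed-cell-step false false true  true  _      _      born with born refl refl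
... | ()
mixed-cell-step false false true  false _      _      _    = refl
mixed-cell-step false false false true  _      _      _    = refl
mixed-cell-step false false false false _      _      _    = refl

-- Odd–odd cell: the four bridges of a 2 × 2 block are never exactly one
-- ON, so the cell stays OFF.
odd-cell-stays-off : ∀ a b c d →
  (false ∨ (b2n (b ∨ d) + b2n (a ∨ c) + b2n (c ∨ d) + b2n (a ∨ b) ≡ᵇ 1)) ≡ false
odd-cell-stays-off true  true  true  true  = refl
odd-cell-stays-off true  true  true  false = refl
odd-cell-stays-off true  true  false true  = refl
odd-cell-stays-off true  true  false false = refl
odd-cell-stays-off true  false true  true  = refl
odd-cell-stays-off true  false true  false = refl
odd-cell-stays-off true  false false true  = refl
odd-cell-stays-off true  false false false = refl
odd-cell-stays-off false true  true  true  = refl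
odd-cell-stays-off false true  true  false = refl
odd-cell-stays-off false true  false true  = refl
odd-cell-stays-off false true  false false = refl
odd-cell-stays-off false false true  true  = refl
odd-cell-stays-off false false true  false = refl
odd-cell-stays-off false false false true  = refl
odd-cell-stays-off false false false false = refl

-- Odd step: from generation 2m + 1 to 2m + 2 only mixed cells change; they
-- catch up with the bridges of generation m + 1.
rescale-odd-step : ∀ m → Rescaling (suc (m + m)) (suc m) m →
                   Rescaling (suc (suc (m + m))) (suc m) (suc m)
rescale-odd-step m R = record
  { even-even = ee ; odd-even = oe ; even-odd = eo ; odd-odd = oo }
  where
  open Rescaling R
  open RescaledNeighbours R
  T = suc (m + m)
  ee : ∀ x y → on (suc T) (twice x) (twice y) ≡ on (suc m) x y
  ee x y rewrite even-even x y | nbrs-even-even x y =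
    even-cell-frozen (on m x y) (on (suc m) x y) (on m (x ℤ.+ + 1) y) (on m (x ℤ.- + 1) y)
      (on m x (y ℤ.+ + 1)) (on m x (y ℤ.- + 1)) (on-mono-false m x y) (off-not-one-neighbour m x y)
  oe : ∀ x y → on (suc T) (twiceSuc x) (twice y) ≡ (on (suc m) x y ∨ on (suc m) (x ℤ.+ + 1) y)
  oe x y rewrite odd-even x y | nbrs-odd-even x y =
    mixed-cell-step (on m x y) (on m (x ℤ.+ + 1) y) (on (suc m) x y) (on (suc m) (x ℤ.+ + 1) y)
      (on-mono m x y) (on-mono m (x ℤ.+ + 1) y) (not-both-born-horizontal m x y)
  eo : ∀ x y → on (suc T) (twice x) (twiceSuc y) ≡ (on (suc m) x y ∨ on (suc m) x (y ℤ.+ + 1))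
  eo x y rewrite even-odd x y | nbrs-even-odd x y =
    mixed-cell-step (on m x y) (on m x (y ℤ.+ + 1)) (on (suc m) x y) (on (suc m) x (y ℤ.+ + 1))
      (on-mono m x y) (on-mono m x (y ℤ.+ + 1)) (not-both-born-vertical m x y)
  oo : ∀ x y → on (suc T) (twiceSuc x) (twiceSuc y) ≡ false
  oo x y rewrite odd-odd x y | nbrs-odd-odd x y =
    odd-cell-stays-off (on m x y) (on m (x ℤ.+ + 1) y) (on m x (y ℤ.+ + 1)) (on m (x ℤ.+ + 1) (y ℤ.+ + 1))

-- Even step: from generation 2m + 2 to 2m + 3 only even–even cells change;
-- they advance one coarse generation.
rescale-even-step : ∀ m → Rescaling (suc (suc (m + m))) (suc m) (suc m) →
                    Rescaling (suc (suc (suc (m + m)))) (suc (suc m)) (suc m)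
rescale-even-step m R = record
  { even-even = ee ; odd-even = oe ; even-odd = eo ; odd-odd = oo }
  where
  open Rescaling R
  open RescaledNeighbours R
  T = suc (suc (m + m))
  B = suc m
  ee : ∀ x y → on (suc T) (twice x) (twice y) ≡ on (suc (suc m)) x y
  ee x y rewrite even-even x y | nbrs-even-even x y =
    even-cell-follows (on B x y) (on B (x ℤ.+ + 1) y) (on B (x ℤ.- + 1) y) (on B x (y ℤ.+ + 1)) (on B x (y ℤ.- + 1))
  oe : ∀ x y → on (suc T) (twiceSuc x) (twice y) ≡ (on B x y ∨ on B (x ℤ.+ + 1) y)
  oe x y rewrite odd-even x y | nbrs-odd-even x y =
    mixed-cell-step (on B x y) (on B (x ℤ.+ + 1) y) (on B x y) (on B (x ℤ.+ + 1) y)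
      (λ h → h) (λ h → h) (λ h _ → cong (_∨ on B (x ℤ.+ + 1) y) h)
  eo : ∀ x y → on (suc T) (twice x) (twiceSuc y) ≡ (on B x y ∨ on B x (y ℤ.+ + 1))
  eo x y rewrite even-odd x y | nbrs-even-odd x y =
    mixed-cell-step (on B x y) (on B x (y ℤ.+ + 1)) (on B x y) (on B x (y ℤ.+ + 1))
      (λ h → h) (λ h → h) (λ h _ → cong (_∨ on B x (y ℤ.+ + 1)) h)
  oo : ∀ x y → on (suc T) (twiceSuc x) (twiceSuc y) ≡ false
  oo x y rewrite odd-odd x y | nbrs-odd-odd x y =
    odd-cell-stays-off (on B x y) (on B (x ℤ.+ + 1) y) (on B x (y ℤ.+ + 1)) (on B (x ℤ.+ + 1) (y ℤ.+ + 1))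

rescale-initial : Rescaling 1 1 0
rescale-initial = record
  { even-even = λ x y → cong₂ _∧_ (isZero-twice x) (isZero-twice y)
  ; odd-even  = λ x y → cong (_∧ isZero (twice y)) (isZero-twiceSuc x)
  ; even-odd  = λ x y → trans (cong (isZero (twice x) ∧_) (isZero-twiceSuc y)) (Boolₚ.∧-zeroʳ _)
  ; odd-odd   = λ x y → cong (_∧ isZero (twiceSuc y)) (isZero-twiceSuc x)
  }
  where
  isZero : ℤ → Bool
  isZero z = ⌊ z ℤ.≟ + 0 ⌋
  isZero-twice : ∀ x → isZero (twice x) ≡ isZero x
  isZero-twice (+ zero)  = refl
  isZero-twice (+ suc n) = refl
  isZero-twice -[1+ n ]  = refl
  isZero-twiceSuc : ∀ x → isZero (twiceSuc x) ≡ false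
  isZero-twiceSuc (+ n)    = refl
  isZero-twiceSuc -[1+ n ] = refl

rescale-odd  : ∀ m → Rescaling (suc (m + m)) (suc m) m
rescale-even : ∀ m → Rescaling (suc (suc (m + m))) (suc m) (suc m)
rescale-odd zero    = rescale-initial
rescale-odd (suc m) =
  subst (λ T → Rescaling T (suc (suc m)) (suc m)) (cong (λ z → suc (suc z)) (sym (ℕₚ.+-suc m m)))
    (rescale-even-step m (rescale-even m))
rescale-even m = rescale-odd-step m (rescale-odd m)

-- (4) Sums over squares

-- sumRange R f = Σ_{-R ≤ x < R} f x, built symmetrically from the inside out.
sumRange : ℕ → (ℤ → ℕ) → ℕ
sumRange zero    f = 0
sumRange (suc R) f = f -[1+ R ] + sumRange R f + f (+ R)

sumRange-cong : ∀ R {f g : ℤ → ℕ} → (∀ x → f x ≡ g x) → sumRange R f ≡ sumRange R g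
sumRange-cong zero    h = refl
sumRange-cong (suc R) h = cong₂ _+_ (cong₂ _+_ (h _) (sumRange-cong R h)) (h _)

sumRange-+ : ∀ R (f g : ℤ → ℕ) → sumRange R (λ x → f x + g x) ≡ sumRange R f + sumRange R g
sumRange-+ zero    f g = refl
sumRange-+ (suc R) f g rewrite sumRange-+ R f g =
  interchange (f -[1+ R ]) (g -[1+ R ]) (sumRange R f) (sumRange R g) (f (+ R)) (g (+ R))
  where
  interchange : ∀ a b s t c d → (a + b) + (s + t) + (c + d) ≡ (a + s + c) + (b + t + d)
  interchange = ℕ-Solver.solve-∀

sumRange-* : ∀ R k (f : ℤ → ℕ) → sumRange R (λ x → k * f x) ≡ k * sumRange R f
sumRange-* zero    k f = sym (ℕₚ.*-zeroʳ k)
sumRange-* (suc R) k f rewrite sumRange-* R k f = factor k _ _ _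
  where
  factor : ∀ k a s c → k * a + k * s + k * c ≡ k * (a + s + c)
  factor = ℕ-Solver.solve-∀

sumRange-zero : ∀ R (f : ℤ → ℕ) → (∀ x → f x ≡ 0) → sumRange R f ≡ 0
sumRange-zero zero    f h = refl
sumRange-zero (suc R) f h rewrite h -[1+ R ] | h (+ R) | sumRange-zero R f h = refl

sumRange-pad : ∀ k R (f : ℤ → ℕ) → (∀ x → R ≤ ∣ x ∣ → f x ≡ 0) → sumRange (k + R) f ≡ sumRange R f
sumRange-pad zero    R f h = refl
sumRange-pad (suc k) R f h
  rewrite h -[1+ k + R ] (ℕₚ.m≤n+m R (suc k)) | h (+ (k + R)) (ℕₚ.m≤n+m R k)
  = trans (ℕₚ.+-identityʳ _) (sumRange-pad k R f h)

sumRange-halve : ∀ R (f : ℤ → ℕ) → sumRange (R + R) f ≡ sumRange R (λ x → f (twice x) + f (twiceSuc x))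
sumRange-halve zero    f = refl
sumRange-halve (suc R) f rewrite ℕₚ.+-suc R R | sumRange-halve R f =
  regroup (f -[1+ suc (R + R) ]) (f -[1+ R + R ]) (sumRange R (λ x → f (twice x) + f (twiceSuc x)))
          (f (+ (R + R))) (f (+ suc (R + R)))
  where
  regroup : ∀ a b s c d → a + (b + s + c) + d ≡ (a + b) + s + (c + d)
  regroup = ℕ-Solver.solve-∀

sumRange-shift : ∀ R (f : ℤ → ℕ) → sumRange R (λ x → f (x ℤ.+ + 1)) + f (ℤ.- (+ R)) ≡ f (+ R) + sumRange R f
sumRange-shift zero    f = ℕₚ.+-comm 0 _
sumRange-shift (suc R) f rewrite negSuc-then-suc R | ℕₚ.+-comm R 1 = begin
    f (ℤ.- (+ R)) + s₁ + f (+ suc R) + f -[1+ R ]   ≡⟨ swap₁ (f (ℤ.- (+ R))) s₁ (f (+ suc R)) (f -[1+ R ]) ⟩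
    (s₁ + f (ℤ.- (+ R))) + f (+ suc R) + f -[1+ R ]
      ≡⟨ cong (λ z → z + f (+ suc R) + f -[1+ R ]) (sumRange-shift R f) ⟩
    (f (+ R) + s₀) + f (+ suc R) + f -[1+ R ]       ≡⟨ swap₂ (f (+ R)) s₀ (f (+ suc R)) (f -[1+ R ]) ⟩
    f (+ suc R) + (f -[1+ R ] + s₀ + f (+ R))       ∎
  where
  open ≡-Reasoning
  s₀ = sumRange R f
  s₁ = sumRange R (λ x → f (x ℤ.+ + 1))
  swap₁ : ∀ a s F N → a + s + F + N ≡ (s + a) + F + N
  swap₁ = ℕ-Solver.solve-∀
  swap₂ : ∀ a s F N → (a + s) + F + N ≡ F + (N + s + a)
  swap₂ = ℕ-Solver.solve-∀

sumRange-shift-vanishing : ∀ R (f : ℤ → ℕ) → f (ℤ.- (+ R)) ≡ 0 → f (+ R) ≡ 0 →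
                           sumRange R (λ x → f (x ℤ.+ + 1)) ≡ sumRange R f
sumRange-shift-vanishing R f left right = begin
    sumRange R (λ x → f (x ℤ.+ + 1))                   ≡⟨ sym (ℕₚ.+-identityʳ _) ⟩
    sumRange R (λ x → f (x ℤ.+ + 1)) + 0
      ≡⟨ cong (λ t → sumRange R (λ x → f (x ℤ.+ + 1)) + t) (sym left) ⟩
    sumRange R (λ x → f (x ℤ.+ + 1)) + f (ℤ.- (+ R))   ≡⟨ sumRange-shift R f ⟩
    f (+ R) + sumRange R f                             ≡⟨ cong (_+ sumRange R f) right ⟩
    sumRange R f                                       ∎
  where open ≡-Reasoning

sumSquare : ℕ → (ℤ → ℤ → ℕ) → ℕ
sumSquare R F = sumRange R (λ x → sumRange R (F x))

sumSquare-cong : ∀ R {F G : ℤ → ℤ → ℕ} → (∀ x y → F x y ≡ G x y) → sumSquare R F ≡ sumSquare R G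
sumSquare-cong R h = sumRange-cong R (λ x → sumRange-cong R (h x))

sumSquare-+ : ∀ R (F G : ℤ → ℤ → ℕ) → sumSquare R (λ x y → F x y + G x y) ≡ sumSquare R F + sumSquare R G
sumSquare-+ R F G = trans (sumRange-cong R (λ x → sumRange-+ R (F x) (G x))) (sumRange-+ R _ _)

sumSquare-* : ∀ R k (F : ℤ → ℤ → ℕ) → sumSquare R (λ x y → k * F x y) ≡ k * sumSquare R F
sumSquare-* R k F = trans (sumRange-cong R (λ x → sumRange-* R k (F x))) (sumRange-* R k _)

sumSquare-grow : ∀ R R' (F : ℤ → ℤ → ℕ) → R ≤ R' → (∀ x y → Outside R x y → F x y ≡ 0) →
                 sumSquare R' F ≡ sumSquare R F
sumSquare-grow R R' F le vanish = begin
    sumSquare R' F           ≡⟨ cong (λ r → sumSquare r F) (sym (ℕₚ.m∸n+n≡m le)) ⟩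
    sumSquare (k + R) F
      ≡⟨ sumRange-cong (k + R) (λ x → sumRange-pad k R (F x) (λ y out → vanish x y (inj₂ out))) ⟩
    sumRange (k + R) (λ x → sumRange R (F x))
      ≡⟨ sumRange-pad k R _ (λ x out → sumRange-zero R (F x) (λ y → vanish x y (inj₁ out))) ⟩
    sumSquare R F            ∎
  where
  open ≡-Reasoning
  k = R' ∸ R

sumSquare-halve : ∀ R (F : ℤ → ℤ → ℕ) → sumSquare (R + R) F ≡
  sumSquare R (λ x y → F (twice x) (twice y) + F (twice x) (twiceSuc y)
                       + F (twiceSuc x) (twice y) + F (twiceSuc x) (twiceSuc y))
sumSquare-halve R F =
  trans (sumRange-halve R _)
  (trans (sumRange-cong R (λ x → cong₂ _+_ (sumRange-halve R (F (twice x))) (sumRange-halve R (F (twiceSuc x)))))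
  (trans (sumRange-cong R (λ x → sym (sumRange-+ R _ _)))
         (sumSquare-cong R (λ x y → sym (ℕₚ.+-assoc (F (twice x) (twice y) + F (twice x) (twiceSuc y)) _ _)))))

sum-concatMap : ∀ {A : Set} (f : A → List ℕ) xs → sum (concatMap f xs) ≡ sum (map (λ x → sum (f x)) xs)
sum-concatMap f []       = refl
sum-concatMap f (x ∷ xs) = trans (sum-++ (f x) _) (cong (λ t → sum (f x) + t) (sum-concatMap f xs))

sumFrom : ℤ → ℕ → (ℤ → ℕ) → ℕ
sumFrom z zero    h = 0
sumFrom z (suc k) h = h z + sumFrom (z ℤ.+ + 1) k h

sum-shifted-list : ∀ k (g : ℕ → ℕ) j w (h : ℤ → ℕ) → (∀ i → g i ≡ j + i) →
                   sum (map h (map (λ i → + i ℤ.+ w) (applyUpTo g k))) ≡ sumFrom (+ j ℤ.+ w) k h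
sum-shifted-list zero    g j w h hg = refl
sum-shifted-list (suc k) g j w h hg =
  cong₂ _+_ (cong (λ t → h (+ t ℤ.+ w)) (trans (hg 0) (ℕₚ.+-identityʳ j)))
    (trans (sum-shifted-list k (λ i → g (suc i)) (suc j) w h (λ i → trans (hg (suc i)) (ℕₚ.+-suc j i)))
           (cong (λ z → sumFrom z k h) (sym (step (+ j) w))))
  where
  step : ∀ a w → (a ℤ.+ w) ℤ.+ + 1 ≡ (+ 1 ℤ.+ a) ℤ.+ w
  step = ℤ-Solver.solve-∀

sum-box : ∀ n (h : ℤ → ℕ) → sum (map h (box n)) ≡ sumFrom (ℤ.- (+ n)) (suc (2 * n)) h
sum-box n h = trans (sum-shifted-list (suc (2 * n)) (λ i → i) 0 (ℤ.- (+ n)) h (λ i → refl))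
                    (cong (λ z → sumFrom z (suc (2 * n)) h) (ℤₚ.+-identityˡ (ℤ.- (+ n))))

sumFrom-snoc : ∀ k z (h : ℤ → ℕ) → sumFrom z (suc k) h ≡ sumFrom z k h + h (z ℤ.+ + k)
sumFrom-snoc zero    z h = trans (ℕₚ.+-identityʳ _) (cong h (sym (ℤₚ.+-identityʳ z)))
sumFrom-snoc (suc k) z h =
  trans (cong (λ t → h z + t) (sumFrom-snoc k (z ℤ.+ + 1) h))
  (trans (sym (ℕₚ.+-assoc (h z) _ _)) (cong (λ t → (h z + sumFrom (z ℤ.+ + 1) k h) + h t) (reassoc z (+ k))))
  where
  reassoc : ∀ z a → (z ℤ.+ + 1) ℤ.+ a ≡ z ℤ.+ (+ 1 ℤ.+ a)
  reassoc = ℤ-Solver.solve-∀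

sumFrom-symmetric : ∀ R (h : ℤ → ℕ) → sumFrom (ℤ.- (+ R)) (suc (2 * R)) h ≡ sumRange R h + h (+ R)
sumFrom-symmetric zero    h = ℕₚ.+-comm _ 0
sumFrom-symmetric (suc R) h = begin
    sumFrom -[1+ R ] (suc (2 * suc R)) h
      ≡⟨ cong (λ k → sumFrom -[1+ R ] (suc k) h) (ℕₚ.*-suc 2 R) ⟩
    h -[1+ R ] + sumFrom (-[1+ R ] ℤ.+ + 1) (suc (suc (2 * R))) h
      ≡⟨ cong (λ z → h -[1+ R ] + sumFrom z (suc (suc (2 * R))) h) (negSuc-then-suc R) ⟩
    h -[1+ R ] + sumFrom (ℤ.- (+ R)) (suc (suc (2 * R))) h
      ≡⟨ cong (λ t → h -[1+ R ] + t) (sumFrom-snoc (suc (2 * R)) (ℤ.- (+ R)) h) ⟩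
    h -[1+ R ] + (sumFrom (ℤ.- (+ R)) (suc (2 * R)) h + h (ℤ.- (+ R) ℤ.+ + suc (2 * R)))
      ≡⟨ cong (λ t → h -[1+ R ] + (t + h (ℤ.- (+ R) ℤ.+ + suc (2 * R)))) (sumFrom-symmetric R h) ⟩
    h -[1+ R ] + (sumRange R h + h (+ R) + h (ℤ.- (+ R) ℤ.+ + suc (2 * R)))
      ≡⟨ cong (λ z → h -[1+ R ] + (sumRange R h + h (+ R) + h z)) (right-end (+ R)) ⟩
    h -[1+ R ] + (sumRange R h + h (+ R) + h (+ suc R))
      ≡⟨ reassoc (h -[1+ R ]) (sumRange R h) (h (+ R)) (h (+ suc R)) ⟩
    sumRange (suc R) h + h (+ suc R) ∎
  where
  open ≡-Reasoning
  right-end : ∀ a → ℤ.- a ℤ.+ (+ 1 ℤ.+ (a ℤ.+ (a ℤ.+ + 0))) ≡ + 1 ℤ.+ a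
  right-end = ℤ-Solver.solve-∀
  reassoc : ∀ a s b c → a + (s + b + c) ≡ a + s + b + c
  reassoc = ℕ-Solver.solve-∀

onF : ℕ → ℤ → ℤ → ℕ
onF n x y = b2n (on n x y)

U-as-sumSquare : ∀ n → U n ≡ sumSquare n (onF n)
U-as-sumSquare n =
  trans (sum-concatMap (λ x → map (onF n x) (box n)) (box n))
  (trans (sum-box n _)
  (trans (sumFrom-symmetric n _)
  (trans (cong₂ _+_ (sumRange-cong n column) right-column)
         (ℕₚ.+-identityʳ _))))
  where
  column : ∀ x → sum (map (onF n x) (box n)) ≡ sumRange n (onF n x)
  column x = trans (sum-box n _) (trans (sumFrom-symmetric n _)
               (trans (cong (λ b → sumRange n (onF n x) + b2n b) (off-outside n x (+ n) (inj₂ ℕₚ.≤-refl)))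
                      (ℕₚ.+-identityʳ _)))
  right-column : sum (map (onF n (+ n)) (box n)) ≡ 0
  right-column = trans (column (+ n))
    (sumRange-zero n _ (λ y → cong b2n (off-outside n (+ n) y (inj₁ ℕₚ.≤-refl))))

U-as-sumSquare-≥ : ∀ n R → n ≤ R → U n ≡ sumSquare R (onF n)
U-as-sumSquare-≥ n R le =
  trans (U-as-sumSquare n)
        (sym (sumSquare-grow n R (onF n) le (λ x y out → cong b2n (off-outside n x y out))))

-- (5) Counting bridges

-- bridges B x y counts the ON bridges (pairs of adjacent cells at least one
-- of which is ON after generation B) leaving (x, y) to the right and upwards.
bridges : ℕ → ℤ → ℤ → ℕ
bridges B x y = b2n (on B x y ∨ on B (x ℤ.+ + 1) y) + b2n (on B x y ∨ on B x (y ℤ.+ + 1))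

-- The rescaling lemma in numbers: the cells ON after generation T are the
-- cells ON after generation A together with one cell per bridge after B.
U-rescaled : ∀ {T A B} → Rescaling T A B → ∀ R → T ≤ R + R → A ≤ R →
             U T ≡ U A + sumSquare R (bridges B)
U-rescaled {T} {A} {B} rescaling R T≤2R A≤R =
  trans (U-as-sumSquare-≥ T (R + R) T≤2R)
  (trans (sumSquare-halve R (onF T))
  (trans (sumSquare-cong R classes)
  (trans (sumSquare-+ R (onF A) (bridges B))
         (cong (_+ sumSquare R (bridges B)) (sym (U-as-sumSquare-≥ A R A≤R))))))
  where
  open Rescaling rescaling
  classes : ∀ x y → onF T (twice x) (twice y) + onF T (twice x) (twiceSuc y)
                    + onF T (twiceSuc x) (twice y) + onF T (twiceSuc x) (twiceSuc y)
                    ≡ onF A x y + bridges B x y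
  classes x y = trans
    (cong₂ _+_ (cong₂ _+_ (cong₂ _+_ (cong b2n (even-even x y)) (cong b2n (even-odd x y)))
                          (cong b2n (odd-even x y))) (cong b2n (odd-odd x y)))
    (regroup (b2n (on A x y)) (b2n (on B x y ∨ on B x (y ℤ.+ + 1))) (b2n (on B x y ∨ on B (x ℤ.+ + 1) y)))
    where
    regroup : ∀ a v h → a + v + h + 0 ≡ a + (h + v)
    regroup = ℕ-Solver.solve-∀

step-inward : ∀ B x → suc B ≤ ∣ x ∣ → B ≤ ∣ x ℤ.+ + 1 ∣
step-inward B x le = ℕₚ.≤-pred (ℕₚ.≤-trans le (∣x∣≤1+∣x+1∣ x))

bridges-outside : ∀ B x y → Outside (suc B) x y → bridges B x y ≡ 0
bridges-outside B x y (inj₁ le)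
  rewrite off-outside B x y (inj₁ (ℕₚ.≤-trans (ℕₚ.n≤1+n B) le))
        | off-outside B (x ℤ.+ + 1) y (inj₁ (step-inward B x le))
        | off-outside B x (y ℤ.+ + 1) (inj₁ (ℕₚ.≤-trans (ℕₚ.n≤1+n B) le)) = refl
bridges-outside B x y (inj₂ le)
  rewrite off-outside B x y (inj₂ (ℕₚ.≤-trans (ℕₚ.n≤1+n B) le))
        | off-outside B (x ℤ.+ + 1) y (inj₂ (ℕₚ.≤-trans (ℕₚ.n≤1+n B) le))
        | off-outside B x (y ℤ.+ + 1) (inj₂ (step-inward B y le)) = refl

-- A bridge p–q is ON after a step iff it was ON before, or it is created by
-- the birth of p or of q (not both: adjacent cells are never born together).
bridge-split : ∀ p q p' q' → (p ≡ true → p' ≡ true) → (q ≡ true → q' ≡ true) →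
  (p' ≡ true → q' ≡ true → (p ∨ q) ≡ true) →
  b2n (p' ∨ q') ≡ b2n (p ∨ q) + b2n ((p' ∧ not p) ∧ not q) + b2n ((q' ∧ not q) ∧ not p)
bridge-split true  q     p'    q'    mono-p _      _ rewrite mono-p refl | Boolₚ.∧-zeroʳ (q' ∧ not q) = refl
bridge-split false true  p'    q'    _      mono-q _
  rewrite mono-q refl | Boolₚ.∨-zeroʳ p' | Boolₚ.∧-zeroʳ (p' ∧ true) = refl
bridge-split false false true  true  _      _      born with born refl refl
... | ()
bridge-split false false true  false _      _      _ = refl
bridge-split false false false true  _      _      _ = refl
bridge-split false false false false _      _      _ = refl

three-off : ∀ r l u d → (b2n r + b2n l + b2n u + b2n d ≡ᵇ 1) ≡ true →
            b2n (not r) + b2n (not l) + b2n (not u) + b2n (not d) ≡ 3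
three-off true  false false false _ = refl
three-off false true  false false _ = refl
three-off false false true  false _ = refl
three-off false false false true  _ = refl
three-off true  true  _     _     ()
three-off true  false true  _     ()
three-off true  false false true  ()
three-off false true  true  _     ()
three-off false true  false true  ()
three-off false false true  true  ()
three-off false false false false ()

newborn-bridges : ∀ n r l u d → (n ≡ true → (b2n r + b2n l + b2n u + b2n d ≡ᵇ 1) ≡ true) →
  b2n (n ∧ not r) + b2n (n ∧ not l) + b2n (n ∧ not u) + b2n (n ∧ not d) ≡ 3 * b2n n
newborn-bridges false r l u d _    = refl
newborn-bridges true  r l u d born = three-off r l u d (born refl)

on-split : ∀ p p' → (p ≡ true → p' ≡ true) → b2n p' ≡ b2n p + b2n (p' ∧ not p)
on-split true  p'    mono rewrite mono refl = refl
on-split false true  _    = refl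
on-split false false _    = refl

sumSquare-+₄ : ∀ R (f g h i : ℤ → ℤ → ℕ) →
  sumSquare R (λ x y → f x y + g x y + h x y + i x y) ≡ sumSquare R f + sumSquare R g + sumSquare R h + sumSquare R i
sumSquare-+₄ R f g h i =
  trans (sumSquare-+ R _ i) (cong (_+ sumSquare R i) (trans (sumSquare-+ R _ h) (cong (_+ sumSquare R h) (sumSquare-+ R f g))))

-- One step k → k + 1 (k = j + 1 ≥ 1), counted in a square of radius R large
-- enough to contain everything: the bridges grow by three per newborn cell.
module BridgeGrowth (j R : ℕ) (large : suc (suc (suc j)) ≤ R) where
  k = suc j

  newborn : ℤ → ℤ → Bool
  newborn x y = on (suc k) x y ∧ not (on k x y)

  bornRight bornFromRight bornLeft bornUp bornFromAbove bornDown : ℤ → ℤ → ℕ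
  bornRight     x y = b2n (newborn x y ∧ not (on k (x ℤ.+ + 1) y))
  bornFromRight x y = b2n (newborn (x ℤ.+ + 1) y ∧ not (on k x y))
  bornLeft      x y = b2n (newborn x y ∧ not (on k (x ℤ.- + 1) y))
  bornUp        x y = b2n (newborn x y ∧ not (on k x (y ℤ.+ + 1)))
  bornFromAbove x y = b2n (newborn x (y ℤ.+ + 1) ∧ not (on k x y))
  bornDown      x y = b2n (newborn x y ∧ not (on k x (y ℤ.- + 1)))

  bridges-step : ∀ x y → bridges (suc k) x y ≡
    bridges k x y + (bornRight x y + bornFromRight x y + bornUp x y + bornFromAbove x y)
  bridges-step x y = trans
    (cong₂ _+_
      (bridge-split (on k x y) (on k (x ℤ.+ + 1) y) (on (suc k) x y) (on (suc k) (x ℤ.+ + 1) y)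
        (on-mono k x y) (on-mono k (x ℤ.+ + 1) y) (not-both-born-horizontal k x y))
      (bridge-split (on k x y) (on k x (y ℤ.+ + 1)) (on (suc k) x y) (on (suc k) x (y ℤ.+ + 1))
        (on-mono k x y) (on-mono k x (y ℤ.+ + 1)) (not-both-born-vertical k x y)))
    (regroup (b2n (on k x y ∨ on k (x ℤ.+ + 1) y)) (b2n (on k x y ∨ on k x (y ℤ.+ + 1)))
             (bornRight x y) (bornFromRight x y) (bornUp x y) (bornFromAbove x y))
    where
    regroup : ∀ H V p q r s → H + p + q + (V + r + s) ≡ (H + V) + (p + q + r + s)
    regroup = ℕ-Solver.solve-∀

  newborn-outside : ∀ x y → Outside R x y → newborn x y ≡ false
  newborn-outside x y out
    rewrite off-outside (suc k) x y (⊎-map (ℕₚ.≤-trans (ℕₚ.≤-trans (ℕₚ.n≤1+n _) large))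
                                                    (ℕₚ.≤-trans (ℕₚ.≤-trans (ℕₚ.n≤1+n _) large)) out) = refl

  ∣-R∣≡R : ∣ ℤ.- (+ R) ∣ ≡ R
  ∣-R∣≡R = ℤₚ.∣-i∣≡∣i∣ (+ R)

  -- Reindexing x ↦ x + 1 turns the bridges created from the right into
  -- bridges created to the left (nothing is born on the boundary).
  sum-bornFromRight : sumSquare R bornFromRight ≡ sumSquare R bornLeft
  sum-bornFromRight =
    trans (sumSquare-cong R (λ x y → cong (λ z → b2n (newborn (x ℤ.+ + 1) y ∧ not (on k z y))) (sym (suc-then-pred x))))
      (sumRange-shift-vanishing R (λ x → sumRange R (bornLeft x))
        (sumRange-zero R _ (λ y → vanish (ℤ.- (+ R)) y (inj₁ (ℕₚ.≤-reflexive (sym ∣-R∣≡R)))))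
        (sumRange-zero R _ (λ y → vanish (+ R) y (inj₁ ℕₚ.≤-refl))))
    where
    vanish : ∀ x y → Outside R x y → bornLeft x y ≡ 0
    vanish x y out rewrite newborn-outside x y out = refl

  sum-bornFromAbove : sumSquare R bornFromAbove ≡ sumSquare R bornDown
  sum-bornFromAbove = sumRange-cong R (λ x →
    trans (sumRange-cong R (λ y → cong (λ z → b2n (newborn x (y ℤ.+ + 1) ∧ not (on k x z))) (sym (suc-then-pred y))))
      (sumRange-shift-vanishing R (bornDown x)
        (vanish x (ℤ.- (+ R)) (inj₂ (ℕₚ.≤-reflexive (sym ∣-R∣≡R))))
        (vanish x (+ R) (inj₂ ℕₚ.≤-refl))))
    where
    vanish : ∀ x y → Outside R x y → bornDown x y ≡ 0
    vanish x y out rewrite newborn-outside x y out = refl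

  newborn-creates-three : ∀ x y → bornRight x y + bornLeft x y + bornUp x y + bornDown x y ≡ 3 * b2n (newborn x y)
  newborn-creates-three x y =
    newborn-bridges (newborn x y) (on k (x ℤ.+ + 1) y) (on k (x ℤ.- + 1) y) (on k x (y ℤ.+ + 1)) (on k x (y ℤ.- + 1))
      (one-neighbour (on k x y))
    where
    one-neighbour : ∀ a → ((a ∨ (onNbrs k x y ≡ᵇ 1)) ∧ not a) ≡ true → (onNbrs k x y ≡ᵇ 1) ≡ true
    one-neighbour false h = trans (sym (Boolₚ.∧-identityʳ _)) h

  births : ℕ
  births = sumSquare R (λ x y → b2n (newborn x y))

  bridges-grow : sumSquare R (bridges (suc k)) ≡ sumSquare R (bridges k) + 3 * births
  bridges-grow = begin
    sumSquare R (bridges (suc k))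
      ≡⟨ trans (sumSquare-cong R bridges-step) (sumSquare-+ R (bridges k) _) ⟩
    sumSquare R (bridges k) + sumSquare R (λ x y → bornRight x y + bornFromRight x y + bornUp x y + bornFromAbove x y)
      ≡⟨ cong (λ t → sumSquare R (bridges k) + t) (begin
           sumSquare R (λ x y → bornRight x y + bornFromRight x y + bornUp x y + bornFromAbove x y)
             ≡⟨ sumSquare-+₄ R bornRight bornFromRight bornUp bornFromAbove ⟩
           sumSquare R bornRight + sumSquare R bornFromRight + sumSquare R bornUp + sumSquare R bornFromAbove
             ≡⟨ cong₂ (λ s t → sumSquare R bornRight + s + sumSquare R bornUp + t)
                      sum-bornFromRight sum-bornFromAbove ⟩
           sumSquare R bornRight + sumSquare R bornLeft + sumSquare R bornUp + sumSquare R bornDown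
             ≡⟨ sym (sumSquare-+₄ R bornRight bornLeft bornUp bornDown) ⟩
           sumSquare R (λ x y → bornRight x y + bornLeft x y + bornUp x y + bornDown x y)
             ≡⟨ trans (sumSquare-cong R newborn-creates-three) (sumSquare-* R 3 _) ⟩
           3 * births ∎) ⟩
    sumSquare R (bridges k) + 3 * births ∎
    where open ≡-Reasoning

  U-grow : U (suc k) ≡ U k + births
  U-grow =
    trans (U-as-sumSquare-≥ (suc k) R k+1≤R)
    (trans (sumSquare-cong R (λ x y → on-split (on k x y) (on (suc k) x y) (on-mono k x y)))
    (trans (sumSquare-+ R (onF k) _)
           (cong (_+ births) (sym (U-as-sumSquare-≥ k R (ℕₚ.≤-trans (ℕₚ.n≤1+n _) k+1≤R))))))
    where
    k+1≤R : suc k ≤ R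
    k+1≤R = ℕₚ.≤-trans (ℕₚ.n≤1+n _) large

  bridges-track-U : sumSquare R (bridges (suc k)) + 3 * U k ≡ sumSquare R (bridges k) + 3 * U (suc k)
  bridges-track-U = begin
    sumSquare R (bridges (suc k)) + 3 * U k             ≡⟨ cong (_+ 3 * U k) bridges-grow ⟩
    sumSquare R (bridges k) + 3 * births + 3 * U k      ≡⟨ regroup (sumSquare R (bridges k)) births (U k) ⟩
    sumSquare R (bridges k) + 3 * (U k + births)        ≡⟨ cong (λ t → sumSquare R (bridges k) + 3 * t) (sym U-grow) ⟩
    sumSquare R (bridges k) + 3 * U (suc k)             ∎
    where
    open ≡-Reasoning
    regroup : ∀ A N u → A + 3 * N + 3 * u ≡ A + 3 * (u + N)
    regroup = ℕ-Solver.solve-∀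

bridge-count : ∀ j → sumSquare (suc (suc j)) (bridges (suc j)) ≡ 3 * U (suc j) + 1
bridge-count zero    = refl
bridge-count (suc j) = ℕₚ.+-cancelˡ-≡ (3 * U (suc j)) _ _ (begin
    3 * U (suc j) + sumSquare R (bridges (suc (suc j)))
      ≡⟨ ℕₚ.+-comm (3 * U (suc j)) _ ⟩
    sumSquare R (bridges (suc (suc j))) + 3 * U (suc j)
      ≡⟨ BridgeGrowth.bridges-track-U j R ℕₚ.≤-refl ⟩
    sumSquare R (bridges (suc j)) + 3 * U (suc (suc j))
      ≡⟨ cong (_+ 3 * U (suc (suc j))) (sumSquare-grow (suc (suc j)) R _ (ℕₚ.n≤1+n _) (bridges-outside (suc j))) ⟩
    sumSquare (suc (suc j)) (bridges (suc j)) + 3 * U (suc (suc j))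
      ≡⟨ cong (_+ 3 * U (suc (suc j))) (bridge-count j) ⟩
    3 * U (suc j) + 1 + 3 * U (suc (suc j))
      ≡⟨ regroup (U (suc j)) (U (suc (suc j))) ⟩
    3 * U (suc j) + (3 * U (suc (suc j)) + 1) ∎)
  where
  open ≡-Reasoning
  R = suc (suc (suc j))
  regroup : ∀ u v → 3 * u + 1 + 3 * v ≡ 3 * u + (3 * v + 1)
  regroup = ℕ-Solver.solve-∀

-- (6) The recurrence for F = 3 · U + 1

F : ℕ → ℕ
F n = 3 * U n + 1

record BinaryRecurrence (f : ℕ → ℕ) : Set where
  field
    at-one  : f 1 ≡ 4
    at-even : ∀ m → f (suc (suc (m + m))) ≡ 4 * f (suc m)
    at-odd  : ∀ m → f (suc (suc (suc (m + m)))) ≡ f (suc (suc m)) + 3 * f (suc m)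

2m+3≤2m+4 : ∀ m → suc (suc (suc (m + m))) ≤ suc (suc m) + suc (suc m)
2m+3≤2m+4 m = subst (suc (suc (suc (m + m))) ≤_) (sym (double m)) (ℕₚ.n≤1+n _)
  where
  double : ∀ m → suc (suc m) + suc (suc m) ≡ suc (suc (suc (suc (m + m))))
  double = ℕ-Solver.solve-∀

-- Generation 2m + 2 consists of generation m + 1 and its 3 · U (m + 1) + 1 bridges.
F-even : ∀ m → F (suc (suc (m + m))) ≡ 4 * F (suc m)
F-even m = begin
    3 * U (suc (suc (m + m))) + 1
      ≡⟨ cong (λ t → 3 * t + 1) (U-rescaled (rescale-even m) (suc (suc m))
                                   (ℕₚ.≤-trans (ℕₚ.n≤1+n _) (2m+3≤2m+4 m)) (ℕₚ.n≤1+n _)) ⟩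
    3 * (U (suc m) + sumSquare (suc (suc m)) (bridges (suc m))) + 1
      ≡⟨ cong (λ t → 3 * (U (suc m) + t) + 1) (bridge-count m) ⟩
    3 * (U (suc m) + (3 * U (suc m) + 1)) + 1
      ≡⟨ regroup (U (suc m)) ⟩
    4 * (3 * U (suc m) + 1) ∎
  where
  open ≡-Reasoning
  regroup : ∀ u → 3 * (u + (3 * u + 1)) + 1 ≡ 4 * (3 * u + 1)
  regroup = ℕ-Solver.solve-∀

-- Generation 2m + 3 consists of generation m + 2 and the bridges of generation m + 1.
F-odd : ∀ m → F (suc (suc (suc (m + m)))) ≡ F (suc (suc m)) + 3 * F (suc m)
F-odd m = begin
    3 * U (suc (suc (suc (m + m)))) + 1
      ≡⟨ cong (λ t → 3 * t + 1) (U-rescaled (rescale-even-step m (rescale-even m)) (suc (suc m))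
                                   (2m+3≤2m+4 m) ℕₚ.≤-refl) ⟩
    3 * (U (suc (suc m)) + sumSquare (suc (suc m)) (bridges (suc m))) + 1
      ≡⟨ cong (λ t → 3 * (U (suc (suc m)) + t) + 1) (bridge-count m) ⟩
    3 * (U (suc (suc m)) + (3 * U (suc m) + 1)) + 1
      ≡⟨ regroup (U (suc (suc m))) (U (suc m)) ⟩
    (3 * U (suc (suc m)) + 1) + 3 * (3 * U (suc m) + 1) ∎
  where
  open ≡-Reasoning
  regroup : ∀ v u → 3 * (v + (3 * u + 1)) + 1 ≡ (3 * v + 1) + 3 * (3 * u + 1)
  regroup = ℕ-Solver.solve-∀

F-recurrence : BinaryRecurrence F
F-recurrence = record { at-one = refl ; at-even = F-even ; at-odd = F-odd }

F-double : ∀ n → 1 ≤ n → F (n + n) ≡ 4 * F n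
F-double (suc m) _ = trans (cong (λ t → F (suc t)) (ℕₚ.+-suc m m)) (F-even m)

F-scale : ∀ n k → 1 ≤ n → F (n * 2 ^ k) ≡ F n * 2 ^ (2 * k)
F-scale n zero    _   = trans (cong F (ℕₚ.*-identityʳ n)) (sym (ℕₚ.*-identityʳ (F n)))
F-scale n (suc k) n≥1 = begin
    F (n * (2 * 2 ^ k))               ≡⟨ cong F (distribute n (2 ^ k)) ⟩
    F (n * 2 ^ k + n * 2 ^ k)         ≡⟨ F-double (n * 2 ^ k) (ℕₚ.*-mono-≤ n≥1 (ℕₚ.m^n>0 2 k)) ⟩
    4 * F (n * 2 ^ k)                 ≡⟨ cong (4 *_) (F-scale n k n≥1) ⟩
    4 * (F n * 2 ^ (2 * k))           ≡⟨ regroup (F n) (2 ^ (2 * k)) ⟩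
    F n * 2 ^ (2 + 2 * k)             ≡⟨ cong (λ e → F n * 2 ^ e) (sym (ℕₚ.*-suc 2 k)) ⟩
    F n * 2 ^ (2 * suc k)             ∎
  where
  open ≡-Reasoning
  distribute : ∀ n p → n * (2 * p) ≡ n * p + n * p
  distribute = ℕ-Solver.solve-∀
  regroup : ∀ x p → 4 * (x * p) ≡ x * (2 * (2 * p))
  regroup = ℕ-Solver.solve-∀

-- (7) The recurrence for a

data Halving : ℕ → Set where
  even : ∀ m → Halving (m + m)
  odd  : ∀ m → Halving (suc (m + m))

halve : ∀ n → Halving n
halve zero = even 0
halve (suc n) with halve n
... | even m = odd m
... | odd m  = subst Halving (cong suc (ℕₚ.+-suc m m)) (even (suc m))

-- A solution of the binary recurrence is determined on n ≥ 1, by strong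
-- induction: 2m + 2 and 2m + 3 are computed from m + 1 and m + 2.
binary-recurrence-unique : ∀ {f g} → BinaryRecurrence f → BinaryRecurrence g → ∀ n → f (suc n) ≡ g (suc n)
binary-recurrence-unique {f} {g} rf rg = <-rec (λ n → f (suc n) ≡ g (suc n)) step
  where
  module Rf = BinaryRecurrence rf
  module Rg = BinaryRecurrence rg
  open ≡-Reasoning
  m<2m+2 : ∀ m → m < suc (suc (m + m))
  m<2m+2 m = ℕₚ.m<n⇒m<1+n (s≤s (ℕₚ.m≤m+n m m))
  step : ∀ n → (∀ {m} → m < n → f (suc m) ≡ g (suc m)) → f (suc n) ≡ g (suc n)
  step zero _ = trans Rf.at-one (sym Rg.at-one)
  step (suc q) ih with halve q
  ... | even m = begin
    f (suc (suc (m + m)))                ≡⟨ Rf.at-even m ⟩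
    4 * f (suc m)                        ≡⟨ cong (4 *_) (ih (s≤s (ℕₚ.m≤m+n m m))) ⟩
    4 * g (suc m)                        ≡⟨ sym (Rg.at-even m) ⟩
    g (suc (suc (m + m)))                ∎
  ... | odd m = begin
    f (suc (suc (suc (m + m))))          ≡⟨ Rf.at-odd m ⟩
    f (suc (suc m)) + 3 * f (suc m)
      ≡⟨ cong₂ (λ s t → s + 3 * t) (ih (s≤s (s≤s (ℕₚ.m≤m+n m m)))) (ih (m<2m+2 m)) ⟩
    g (suc (suc m)) + 3 * g (suc m)      ≡⟨ sym (Rg.at-odd m) ⟩
    g (suc (suc (suc (m + m))))          ∎

a-suc : ∀ n → a (suc n) ≡ a n + 3 ^ wt n
a-suc n = sum-snoc n (λ i → i)
  where
  sum-snoc : ∀ n (g : ℕ → ℕ) → sum (map (λ i → 3 ^ wt i) (applyUpTo g (suc n)))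
                              ≡ sum (map (λ i → 3 ^ wt i) (applyUpTo g n)) + 3 ^ wt (g n)
  sum-snoc zero    g = ℕₚ.+-comm (3 ^ wt (g 0)) 0
  sum-snoc (suc n) g = trans (cong (λ t → 3 ^ wt (g 0) + t) (sum-snoc n (λ i → g (suc i))))
                             (sym (ℕₚ.+-assoc (3 ^ wt (g 0)) _ _))

wtAux-zero : ∀ f → wtAux f 0 ≡ 0
wtAux-zero zero    = refl
wtAux-zero (suc f) = wtAux-zero f

half-≤ : ∀ i f → i ≤ suc f → i / 2 ≤ f
half-≤ zero    f le = z≤n
half-≤ (suc i) f le = ℕₚ.≤-pred (ℕₚ.≤-trans (DivMod.m/n<m (suc i) 2 (s≤s (s≤s z≤n))) le)

wtAux-fuel : ∀ f g i → i ≤ f → i ≤ g → wtAux f i ≡ wtAux g i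
wtAux-fuel zero    g       .zero z≤n q   = sym (wtAux-zero g)
wtAux-fuel (suc f) zero    .zero p   z≤n = wtAux-zero (suc f)
wtAux-fuel (suc f) (suc g) i     p   q   =
  cong (λ t → i % 2 + t) (wtAux-fuel f g (i / 2) (half-≤ i f p) (half-≤ i g q))

-- Doubling in the form used by the division lemmas.
n+n≡n*2 : ∀ n → n + n ≡ n * 2
n+n≡n*2 = ℕ-Solver.solve-∀

wt-even : ∀ n → wt (n + n) ≡ wt n
wt-even zero    = refl
wt-even (suc n) =
  trans (cong₂ _+_ (trans (cong (_% 2) (n+n≡n*2 (suc n))) (DivMod.m*n%n≡0 (suc n) 2))
                   (cong (wtAux (n + suc n)) (trans (cong (_/ 2) (n+n≡n*2 (suc n))) (DivMod.m*n/n≡m (suc n) 2))))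
        (wtAux-fuel (n + suc n) (suc n) (suc n) (ℕₚ.m≤n+m (suc n) n) ℕₚ.≤-refl)

wt-odd : ∀ n → wt (suc (n + n)) ≡ suc (wt n)
wt-odd n =
  trans (cong₂ _+_ odd-mod (cong (wtAux (n + n)) odd-div))
        (cong suc (wtAux-fuel (n + n) n n (ℕₚ.m≤m+n n n) ℕₚ.≤-refl))
  where
  odd-mod : suc (n + n) % 2 ≡ 1
  odd-mod rewrite n+n≡n*2 n = DivMod.[m+kn]%n≡m%n 1 n 2
  odd-div : suc (n + n) / 2 ≡ n
  odd-div rewrite n+n≡n*2 n =
    trans (DivMod.+-distrib-/ 1 (n * 2) (subst (λ t → 1 + t < 2) (sym (DivMod.m*n%n≡0 n 2)) (s≤s (s≤s z≤n))))
          (DivMod.m*n/n≡m n 2)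

-- The terms i < 2n split into the even ones 2i (weight wt i) and the odd
-- ones 2i + 1 (weight wt i + 1), whence a (2n) = 4 · a n.
a-even : ∀ n → a (n + n) ≡ 4 * a n
a-even zero    = refl
a-even (suc n) = begin
    a (suc n + suc n)                              ≡⟨ cong (λ t → a (suc t)) (ℕₚ.+-suc n n) ⟩
    a (suc (suc (n + n)))                          ≡⟨ a-suc (suc (n + n)) ⟩
    a (suc (n + n)) + 3 ^ wt (suc (n + n))         ≡⟨ cong₂ _+_ (a-suc (n + n)) (cong (3 ^_) (wt-odd n)) ⟩
    a (n + n) + 3 ^ wt (n + n) + 3 * 3 ^ wt n      ≡⟨ cong₂ (λ s t → s + 3 ^ t + 3 * 3 ^ wt n) (a-even n) (wt-even n) ⟩
    4 * a n + 3 ^ wt n + 3 * 3 ^ wt n              ≡⟨ regroup (a n) (3 ^ wt n) ⟩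
    4 * (a n + 3 ^ wt n)                           ≡⟨ cong (4 *_) (sym (a-suc n)) ⟩
    4 * a (suc n)                                  ∎
  where
  open ≡-Reasoning
  regroup : ∀ x w → 4 * x + w + 3 * w ≡ 4 * (x + w)
  regroup = ℕ-Solver.solve-∀

a-odd : ∀ n → a (suc (n + n)) ≡ 3 * a n + a (suc n)
a-odd n = begin
    a (suc (n + n))                    ≡⟨ a-suc (n + n) ⟩
    a (n + n) + 3 ^ wt (n + n)         ≡⟨ cong₂ _+_ (a-even n) (cong (3 ^_) (wt-even n)) ⟩
    4 * a n + 3 ^ wt n                 ≡⟨ regroup (a n) (3 ^ wt n) ⟩
    3 * a n + (a n + 3 ^ wt n)         ≡⟨ cong (λ t → 3 * a n + t) (sym (a-suc n)) ⟩
    3 * a n + a (suc n)                ∎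
  where
  open ≡-Reasoning
  regroup : ∀ x w → 4 * x + w ≡ 3 * x + (x + w)
  regroup = ℕ-Solver.solve-∀

4a-recurrence : BinaryRecurrence (λ n → 4 * a n)
4a-recurrence = record
  { at-one  = refl
  ; at-even = λ m → cong (4 *_) (trans (cong (λ t → a (suc t)) (sym (ℕₚ.+-suc m m))) (a-even (suc m)))
  ; at-odd  = λ m → trans (cong (4 *_) (trans (cong (λ t → a (suc (suc t))) (sym (ℕₚ.+-suc m m))) (a-odd (suc m))))
                          (regroup (a (suc m)) (a (suc (suc m))))
  }
  where
  regroup : ∀ x y → 4 * (3 * x + y) ≡ 4 * y + 3 * (4 * x)
  regroup = ℕ-Solver.solve-∀

F≡4a : ∀ n → 1 ≤ n → F n ≡ 4 * a n
F≡4a (suc n) _ = binary-recurrence-unique F-recurrence 4a-recurrence n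

mainTheorem1 : ∀ (m k : ℕ) → m ≥ 1 →
    3 * U (m * 2 ^ k) + 1 ≡ 4 * a m * 2 ^ (2 * k)
mainTheorem1 m k m≥1 = begin
    F (m * 2 ^ k)           ≡⟨ F-scale m k m≥1 ⟩
    F m * 2 ^ (2 * k)       ≡⟨ cong (_* 2 ^ (2 * k)) (F≡4a m m≥1) ⟩
    4 * a m * 2 ^ (2 * k)   ∎
  where open ≡-Reasoning
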